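{- Let $p\in\{0,1\}^m$ with $m\ge1$, and suppose $\delta(q_m,\overline{p[m]})=q_{m-k+1}$ for some $1\le k\le m$, where $\overline{p[m]}=1-p[m]$. For $0\le i\le m$ let $P_i(\lambda)$ be the characteristic polynomial of the prefix $p[1..i]$ (with $P_0(\lambda)=1$). Then $P_m(\lambda)=\lambda P_{m-1}(\lambda)-(-1)^{wt(p[1..k])}P_{m-k}(\lambda)$ if $k<m$, and $P_m(\lambda)=\lambda P_{m-1}(\lambda)+(-1)^{wt(p[1..m])}$ if $k=m$.
   Context: Strings indexed from 1; $wt(s)$ is the number of 1's in $s$. For a binary pattern $w$ of length $r$, its KMP automaton has states $q_1,\dots,q_{r+1}$ and transition function $\delta$: $\delta(q_{r+1},c)=q_{r+1}$; $\delta(q_r,w[r])=q_{r+1}$; otherwise, for $1\le i\le r$, $\delta(q_i,c)=q_j$ where $j-1$ is the largest length of a suffix of $w[1..i-1]c$ that is a prefix of $w$ (in the claim, $\delta$ is that of $p$). The transition matrix $T_w$ is the $r\times r$ integer matrix with $(j,i)$ entry $\sum_{c\in\{0,1\}:\ \delta(q_i,c)=q_j}(-1)^c$, and the characteristic polynomial of $w$ is $\det(\lambda I-T_w)$. -}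

module Defs where

open import Data.Bool using (Bool; true; false; if_then_else_; not)
open import Data.Nat using (ℕ; zero; suc; _∸_; _≡ᵇ_)
open import Data.Integer using (ℤ; +_; -_) renaming (_+_ to _+ℤ_; _*_ to _*ℤ_)
open import Data.List using (List; []; _∷_; length; take; drop; _++_; [_])
open import Data.List.Properties using (≡-dec)
open import Data.Fin using (Fin; toℕ; punchIn) renaming (zero to fzero; suc to fsuc)
open import Relation.Nullary.Decidable using (does)
open import Relation.Binary.PropositionalEquality using (_≡_)
import Data.Bool.Properties as BoolP

-- Polynomials in λ with integer coefficients: coefficient lists,
-- lowest degree first.  Equality is coefficientwise.

Poly : Set
Poly = List ℤ

coeff : Poly → ℕ → ℤ
coeff []       _       = + 0
coeff (a ∷ _)  zero    = a
coeff (_ ∷ as) (suc n) = coeff as n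

_≈ₚ_ : Poly → Poly → Set
p ≈ₚ q = ∀ n → coeff p n ≡ coeff q n

infix 4 _≈ₚ_
infixl 6 _+ₚ_ _-ₚ_
infixl 7 _*ₚ_ _·ₚ_

_+ₚ_ : Poly → Poly → Poly
[]       +ₚ q        = q
p        +ₚ []       = p
(a ∷ as) +ₚ (b ∷ bs) = (a +ℤ b) ∷ (as +ₚ bs)

_·ₚ_ : ℤ → Poly → Poly
c ·ₚ []       = []
c ·ₚ (a ∷ as) = (c *ℤ a) ∷ (c ·ₚ as)

-ₚ_ : Poly → Poly
-ₚ p = (- (+ 1)) ·ₚ p

_-ₚ_ : Poly → Poly → Poly
p -ₚ q = p +ₚ (-ₚ q)

_*ₚ_ : Poly → Poly → Poly
[]       *ₚ q = []
(a ∷ as) *ₚ q = (a ·ₚ q) +ₚ (+ 0 ∷ (as *ₚ q))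

constₚ : ℤ → Poly
constₚ c = [ c ]

X : Poly
X = + 0 ∷ + 1 ∷ []

-- Determinant (Laplace expansion along the first row) of a square
-- matrix with polynomial entries, M row col.

sumFin : ∀ {n} → (Fin n → Poly) → Poly
sumFin {zero}  f = []
sumFin {suc n} f = f fzero +ₚ sumFin (λ i → f (fsuc i))

signℕ : ℕ → ℤ
signℕ zero    = + 1
signℕ (suc n) = - signℕ n

det : ∀ n → (Fin n → Fin n → Poly) → Poly
det zero    M = constₚ (+ 1)
det (suc n) M =
  sumFin (λ k → signℕ (toℕ k) ·ₚ (M fzero k *ₚ
    det n (λ a b → M (fsuc a) (punchIn k b))))

-- KMP automaton of a binary pattern w (true = 1, false = 0), r = length w.
-- State q_i (1 ≤ i ≤ r+1) is represented by the natural number i - 1.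

_≟L_ : (u v : List Bool) → Bool
u ≟L v = does (≡-dec BoolP._≟_ u v)

border : List Bool → List Bool → ℕ → ℕ
border u w zero    = zero
border u w (suc L) =
  if drop (length u ∸ suc L) u ≟L take (suc L) w then suc L else border u w L

δ : List Bool → ℕ → Bool → ℕ
δ w s c =
  if s ≡ᵇ length w then length w
  else border (take s w ++ [ c ]) w (suc s)

bitSign : Bool → ℤ
bitSign false = + 1
bitSign true  = - (+ 1)

-- (j,i) entry (0-based indices for states q_{j+1}, q_{i+1}) of T_w
Tw : (w : List Bool) → Fin (length w) → Fin (length w) → ℤ
Tw w j i =
  (if δ w (toℕ i) false ≡ᵇ toℕ j then bitSign false else + 0) +ℤ
  (if δ w (toℕ i) true  ≡ᵇ toℕ j then bitSign true  else + 0)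

charMat : (w : List Bool) → Fin (length w) → Fin (length w) → Poly
charMat w j i =
  (if toℕ j ≡ᵇ toℕ i then X else []) -ₚ constₚ (Tw w j i)

charPoly : List Bool → Poly
charPoly w = det (length w) (charMat w)

wt : List Bool → ℕ
wt []           = zero
wt (true ∷ s)   = suc (wt s)
wt (false ∷ s)  = wt s

-- s[i], 1-based (default false out of range)
at : List Bool → ℕ → Bool
at []      _             = false
at (x ∷ _) (suc zero)    = x
at (_ ∷ s) (suc (suc i)) = at s (suc i)
at (_ ∷ _) zero          = false

P : List Bool → ℕ → Poly
P p i = charPoly (take i p)

-- The KMP automaton advances by at most one state per letter, so λI - T_p is lower Hessenberg,
-- and its leading i × i minors are the characteristic polynomials P_i of the prefixes p[1..i].
-- In the last column (state q_m) the letter p[m] leads to the accepting state, which has no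
-- row, so the column has only two non-zero entries: λ on the diagonal and -(-1)^{¬p[m]} in
-- row m - k + 1. The diagonal entry contributes λ P_{m-1}. Deleting row m - k + 1 instead
-- leaves a block lower triangular minor with diagonal blocks P_{m-k} and the subdiagonal
-- entries -(-1)^{p[i]} (m - k < i < m), so that term is (-1)^{wt(p[m-k+1..m])} P_{m-k}.
-- Finally, the mismatch transition means p[1..m-k] = p[k+1..m-1] ¬p[m]; comparing weights
-- turns the sign into -(-1)^{wt(p[1..k])}, and into (-1)^{wt p} when k = m.
module Submission where

open import Defs
open import Data.Bool using (Bool; true; false; if_then_else_; not)
import Data.Bool.Properties as BoolP
open import Data.Nat using (ℕ; zero; suc; _+_; _∸_; _≡ᵇ_; _≤_; _<_; z≤n; s≤s)
import Data.Nat.Properties as ℕP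
open import Data.Integer using (ℤ; +_; -_) renaming (_+_ to _+ℤ_; _*_ to _*ℤ_)
import Data.Integer.Properties as ℤP
open import Data.Integer.Tactic.RingSolver using (solve-∀)
open import Data.List using (List; []; _∷_; length; take; drop; _++_; [_])
open import Data.List.Properties
  using (≡-dec; ∷ʳ-injectiveʳ; length-++; length-take; length-drop; take-take; take-all; take++drop≡id)
open import Data.Fin using (Fin; toℕ; punchIn; punchOut; fromℕ; fromℕ<; inject₁) renaming (zero to fzero; suc to fsuc)
import Data.Fin.Properties as FP
open import Data.Product using (_×_; _,_)
open import Function using (_∘_; Equivalence)
open import Relation.Nullary.Decidable using (yes; no; dec-true)
open import Relation.Binary.PropositionalEquality hiding ([_])
open import Relation.Binary.Bundles using (Setoid)
import Relation.Binary.Reasoning.Setoid as SetoidReasoning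

-- Polynomial arithmetic

infix 4 _≋_

-- _≈ₚ_ wrapped in a record, so that both polynomials can be inferred from a proof.
record _≋_ (p q : Poly) : Set where
  constructor mk≋
  field coeff-≡ : p ≈ₚ q
open _≋_ public

≋-refl : ∀ {p} → p ≋ p
≋-refl = mk≋ λ _ → refl

≋-sym : ∀ {p q} → p ≋ q → q ≋ p
≋-sym p≋q = mk≋ λ n → sym (coeff-≡ p≋q n)

≋-trans : ∀ {p q r} → p ≋ q → q ≋ r → p ≋ r
≋-trans p≋q q≋r = mk≋ λ n → trans (coeff-≡ p≋q n) (coeff-≡ q≋r n)

≡⇒≋ : ∀ {p q} → p ≡ q → p ≋ q
≡⇒≋ refl = ≋-refl

≋-setoid : Setoid _ _
≋-setoid = record
  { Carrier = Poly ; _≈_ = _≋_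
  ; isEquivalence = record { refl = ≋-refl ; sym = ≋-sym ; trans = ≋-trans } }

coeff-+ₚ : ∀ p q n → coeff (p +ₚ q) n ≡ coeff p n +ℤ coeff q n
coeff-+ₚ []       q        n       = sym (ℤP.+-identityˡ _)
coeff-+ₚ (a ∷ as) []       n       = sym (ℤP.+-identityʳ _)
coeff-+ₚ (a ∷ as) (b ∷ bs) zero    = refl
coeff-+ₚ (a ∷ as) (b ∷ bs) (suc n) = coeff-+ₚ as bs n

coeff-·ₚ : ∀ c p n → coeff (c ·ₚ p) n ≡ c *ℤ coeff p n
coeff-·ₚ c []       n       = sym (ℤP.*-zeroʳ c)
coeff-·ₚ c (a ∷ as) zero    = refl
coeff-·ₚ c (a ∷ as) (suc n) = coeff-·ₚ c as n

infix 5 _⋆_ _⋆₊_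

-- (f ⋆ q) n = Σ_{i ≤ n} f i * coeff q (n - i)
_⋆_ : (ℕ → ℤ) → Poly → ℕ → ℤ
(f ⋆ q) zero    = f 0 *ℤ coeff q 0
(f ⋆ q) (suc n) = f 0 *ℤ coeff q (suc n) +ℤ ((f ∘ suc) ⋆ q) n

coeff-*ₚ : ∀ p q n → coeff (p *ₚ q) n ≡ (coeff p ⋆ q) n
coeff-*ₚ [] q zero    = sym (ℤP.*-zeroˡ (coeff q 0))
coeff-*ₚ [] q (suc n) = sym (begin
  + 0 *ℤ coeff q (suc n) +ℤ (coeff [] ⋆ q) n ≡⟨ cong (_+ℤ (coeff [] ⋆ q) n) (ℤP.*-zeroˡ (coeff q (suc n))) ⟩
  + 0 +ℤ (coeff [] ⋆ q) n                    ≡⟨ ℤP.+-identityˡ ((coeff [] ⋆ q) n) ⟩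
  (coeff [] ⋆ q) n                           ≡⟨ sym (coeff-*ₚ [] q n) ⟩
  + 0                                        ∎)
  where open ≡-Reasoning
coeff-*ₚ (a ∷ as) q zero    = trans (coeff-+ₚ (a ·ₚ q) _ 0) (trans (ℤP.+-identityʳ _) (coeff-·ₚ a q 0))
coeff-*ₚ (a ∷ as) q (suc n) =
  trans (coeff-+ₚ (a ·ₚ q) _ (suc n)) (cong₂ _+ℤ_ (coeff-·ₚ a q (suc n)) (coeff-*ₚ as q n))

⋆-cong : ∀ {f g} q → (∀ i → f i ≡ g i) → ∀ n → (f ⋆ q) n ≡ (g ⋆ q) n
⋆-cong q f≗g zero    = cong (_*ℤ coeff q 0) (f≗g 0)
⋆-cong q f≗g (suc n) = cong₂ _+ℤ_ (cong (_*ℤ coeff q (suc n)) (f≗g 0)) (⋆-cong q (f≗g ∘ suc) n)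

⋆-distrib-+ˡ : ∀ f g q n → ((λ i → f i +ℤ g i) ⋆ q) n ≡ (f ⋆ q) n +ℤ (g ⋆ q) n
⋆-distrib-+ˡ f g q zero    = ℤP.*-distribʳ-+ _ (f 0) (g 0)
⋆-distrib-+ˡ f g q (suc n) rewrite ⋆-distrib-+ˡ (f ∘ suc) (g ∘ suc) q n =
  shuffle (f 0) (g 0) (coeff q (suc n)) ((f ∘ suc ⋆ q) n) ((g ∘ suc ⋆ q) n)
  where
  shuffle : ∀ a b c x y → (a +ℤ b) *ℤ c +ℤ (x +ℤ y) ≡ (a *ℤ c +ℤ x) +ℤ (b *ℤ c +ℤ y)
  shuffle = solve-∀

⋆-distrib-+ʳ : ∀ f q r n → (f ⋆ (q +ₚ r)) n ≡ (f ⋆ q) n +ℤ (f ⋆ r) n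
⋆-distrib-+ʳ f q r zero rewrite coeff-+ₚ q r 0 = ℤP.*-distribˡ-+ (f 0) _ _
⋆-distrib-+ʳ f q r (suc n) rewrite coeff-+ₚ q r (suc n) | ⋆-distrib-+ʳ (f ∘ suc) q r n =
  shuffle (f 0) (coeff q (suc n)) (coeff r (suc n)) ((f ∘ suc ⋆ q) n) ((f ∘ suc ⋆ r) n)
  where
  shuffle : ∀ a b c x y → a *ℤ (b +ℤ c) +ℤ (x +ℤ y) ≡ (a *ℤ b +ℤ x) +ℤ (a *ℤ c +ℤ y)
  shuffle = solve-∀

⋆-scaleˡ : ∀ c f q n → ((λ i → c *ℤ f i) ⋆ q) n ≡ c *ℤ (f ⋆ q) n
⋆-scaleˡ c f q zero    = ℤP.*-assoc c _ _
⋆-scaleˡ c f q (suc n) rewrite ⋆-scaleˡ c (f ∘ suc) q n =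
  shuffle c (f 0) (coeff q (suc n)) ((f ∘ suc ⋆ q) n)
  where
  shuffle : ∀ c a b x → c *ℤ a *ℤ b +ℤ c *ℤ x ≡ c *ℤ (a *ℤ b +ℤ x)
  shuffle = solve-∀

⋆-scaleʳ : ∀ c f q n → (f ⋆ (c ·ₚ q)) n ≡ c *ℤ (f ⋆ q) n
⋆-scaleʳ c f q zero rewrite coeff-·ₚ c q 0 = shuffle c (f 0) (coeff q 0)
  where
  shuffle : ∀ c a b → a *ℤ (c *ℤ b) ≡ c *ℤ (a *ℤ b)
  shuffle = solve-∀
⋆-scaleʳ c f q (suc n) rewrite coeff-·ₚ c q (suc n) | ⋆-scaleʳ c (f ∘ suc) q n =
  shuffle c (f 0) (coeff q (suc n)) ((f ∘ suc ⋆ q) n)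
  where
  shuffle : ∀ c a b x → a *ℤ (c *ℤ b) +ℤ c *ℤ x ≡ c *ℤ (a *ℤ b +ℤ x)
  shuffle = solve-∀

⋆-[] : ∀ f n → (f ⋆ []) n ≡ + 0
⋆-[] f zero    = ℤP.*-zeroʳ (f 0)
⋆-[] f (suc n) rewrite ⋆-[] (f ∘ suc) n | ℤP.*-zeroʳ (f 0) = refl

_⋆₊_ : (ℕ → ℤ) → Poly → ℕ → ℤ
(f ⋆₊ as) zero    = + 0
(f ⋆₊ as) (suc n) = (f ⋆ as) n

⋆-∷ : ∀ f a as n → (f ⋆ (a ∷ as)) n ≡ a *ℤ f n +ℤ (f ⋆₊ as) n
⋆-∷ f a as zero = shuffle (f 0) a
  where
  shuffle : ∀ x a → x *ℤ a ≡ a *ℤ x +ℤ + 0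
  shuffle = solve-∀
⋆-∷ f a as (suc zero) rewrite ⋆-∷ (f ∘ suc) a as zero = shuffle (f 0) (coeff as 0) a (f 1)
  where
  shuffle : ∀ x b a y → x *ℤ b +ℤ (a *ℤ y +ℤ + 0) ≡ a *ℤ y +ℤ x *ℤ b
  shuffle = solve-∀
⋆-∷ f a as (suc (suc n)) rewrite ⋆-∷ (f ∘ suc) a as (suc n) =
  shuffle (f 0) (coeff as (suc n)) a (f (suc (suc n))) ((f ∘ suc ⋆ as) n)
  where
  shuffle : ∀ x b a y z → x *ℤ b +ℤ (a *ℤ y +ℤ z) ≡ a *ℤ y +ℤ (x *ℤ b +ℤ z)
  shuffle = solve-∀

+ₚ-cong : ∀ {p p′ q q′} → p ≋ p′ → q ≋ q′ → p +ₚ q ≋ p′ +ₚ q′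
+ₚ-cong {p} {p′} {q} {q′} p≋p′ q≋q′ = mk≋ λ n →
  trans (coeff-+ₚ p q n) (trans (cong₂ _+ℤ_ (coeff-≡ p≋p′ n) (coeff-≡ q≋q′ n)) (sym (coeff-+ₚ p′ q′ n)))

·ₚ-congˡ : ∀ c {p p′} → p ≋ p′ → c ·ₚ p ≋ c ·ₚ p′
·ₚ-congˡ c {p} {p′} p≋p′ = mk≋ λ n →
  trans (coeff-·ₚ c p n) (trans (cong (c *ℤ_) (coeff-≡ p≋p′ n)) (sym (coeff-·ₚ c p′ n)))

·ₚ-congʳ : ∀ {c d} p → c ≡ d → c ·ₚ p ≋ d ·ₚ p
·ₚ-congʳ p refl = ≋-refl

∷-cong : ∀ a {p p′} → p ≋ p′ → a ∷ p ≋ a ∷ p′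
∷-cong a p≋p′ = mk≋ λ { zero → refl ; (suc n) → coeff-≡ p≋p′ n }

*ₚ-congʳ : ∀ {p p′} q → p ≋ p′ → p *ₚ q ≋ p′ *ₚ q
*ₚ-congʳ {p} {p′} q p≋p′ = mk≋ λ n →
  trans (coeff-*ₚ p q n) (trans (⋆-cong q (coeff-≡ p≋p′) n) (sym (coeff-*ₚ p′ q n)))

*ₚ-congˡ : ∀ p {q q′} → q ≋ q′ → p *ₚ q ≋ p *ₚ q′
*ₚ-congˡ []       q≋q′ = ≋-refl
*ₚ-congˡ (a ∷ as) q≋q′ = +ₚ-cong (·ₚ-congˡ a q≋q′) (∷-cong (+ 0) (*ₚ-congˡ as q≋q′))

*ₚ-cong : ∀ {p p′ q q′} → p ≋ p′ → q ≋ q′ → p *ₚ q ≋ p′ *ₚ q′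
*ₚ-cong {p′ = p′} {q = q} p≋p′ q≋q′ = ≋-trans (*ₚ-congʳ q p≋p′) (*ₚ-congˡ p′ q≋q′)

+ₚ-comm : ∀ p q → p +ₚ q ≋ q +ₚ p
+ₚ-comm p q = mk≋ λ n →
  trans (coeff-+ₚ p q n) (trans (ℤP.+-comm (coeff p n) (coeff q n)) (sym (coeff-+ₚ q p n)))

+ₚ-assoc : ∀ p q r → (p +ₚ q) +ₚ r ≋ p +ₚ (q +ₚ r)
+ₚ-assoc p q r = mk≋ λ n → begin
  coeff ((p +ₚ q) +ₚ r) n              ≡⟨ coeff-+ₚ (p +ₚ q) r n ⟩
  coeff (p +ₚ q) n +ℤ coeff r n        ≡⟨ cong (_+ℤ coeff r n) (coeff-+ₚ p q n) ⟩
  coeff p n +ℤ coeff q n +ℤ coeff r n  ≡⟨ ℤP.+-assoc (coeff p n) (coeff q n) (coeff r n) ⟩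
  coeff p n +ℤ (coeff q n +ℤ coeff r n) ≡⟨ cong (coeff p n +ℤ_) (sym (coeff-+ₚ q r n)) ⟩
  coeff p n +ℤ coeff (q +ₚ r) n        ≡⟨ sym (coeff-+ₚ p (q +ₚ r) n) ⟩
  coeff (p +ₚ (q +ₚ r)) n              ∎
  where open ≡-Reasoning

+ₚ-identityʳ : ∀ p → p +ₚ [] ≋ p
+ₚ-identityʳ p = mk≋ λ n → trans (coeff-+ₚ p [] n) (ℤP.+-identityʳ _)

+ₚ-interchange : ∀ a b c d → (a +ₚ b) +ₚ (c +ₚ d) ≋ (a +ₚ c) +ₚ (b +ₚ d)
+ₚ-interchange a b c d = begin
  (a +ₚ b) +ₚ (c +ₚ d) ≈⟨ +ₚ-assoc a b _ ⟩
  a +ₚ (b +ₚ (c +ₚ d)) ≈⟨ +ₚ-cong (≋-refl {a}) (≋-sym (+ₚ-assoc b c d)) ⟩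
  a +ₚ ((b +ₚ c) +ₚ d) ≈⟨ +ₚ-cong (≋-refl {a}) (+ₚ-cong (+ₚ-comm b c) (≋-refl {d})) ⟩
  a +ₚ ((c +ₚ b) +ₚ d) ≈⟨ +ₚ-cong (≋-refl {a}) (+ₚ-assoc c b d) ⟩
  a +ₚ (c +ₚ (b +ₚ d)) ≈⟨ ≋-sym (+ₚ-assoc a c _) ⟩
  (a +ₚ c) +ₚ (b +ₚ d) ∎
  where open SetoidReasoning ≋-setoid

·ₚ-distrib-+ₚ : ∀ c p q → c ·ₚ (p +ₚ q) ≋ c ·ₚ p +ₚ c ·ₚ q
·ₚ-distrib-+ₚ c p q = mk≋ λ n → trans (coeff-·ₚ c (p +ₚ q) n) (trans (cong (c *ℤ_) (coeff-+ₚ p q n))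
  (trans (ℤP.*-distribˡ-+ c _ _)
    (sym (trans (coeff-+ₚ (c ·ₚ p) _ n) (cong₂ _+ℤ_ (coeff-·ₚ c p n) (coeff-·ₚ c q n))))))

·ₚ-assoc : ∀ c d p → c ·ₚ (d ·ₚ p) ≋ (c *ℤ d) ·ₚ p
·ₚ-assoc c d p = mk≋ λ n → trans (coeff-·ₚ c (d ·ₚ p) n) (trans (cong (c *ℤ_) (coeff-·ₚ d p n))
  (trans (sym (ℤP.*-assoc c d _)) (sym (coeff-·ₚ (c *ℤ d) p n))))

·ₚ-identityˡ : ∀ p → + 1 ·ₚ p ≋ p
·ₚ-identityˡ p = mk≋ λ n → trans (coeff-·ₚ _ p n) (ℤP.*-identityˡ _)

*ₚ-distribʳ-+ₚ : ∀ p q r → (p +ₚ q) *ₚ r ≋ p *ₚ r +ₚ q *ₚ r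
*ₚ-distribʳ-+ₚ p q r = mk≋ λ n → trans (coeff-*ₚ (p +ₚ q) r n) (trans (⋆-cong r (coeff-+ₚ p q) n)
  (trans (⋆-distrib-+ˡ _ _ r n)
    (sym (trans (coeff-+ₚ (p *ₚ r) _ n) (cong₂ _+ℤ_ (coeff-*ₚ p r n) (coeff-*ₚ q r n))))))

*ₚ-distribˡ-+ₚ : ∀ p q r → p *ₚ (q +ₚ r) ≋ p *ₚ q +ₚ p *ₚ r
*ₚ-distribˡ-+ₚ p q r = mk≋ λ n → trans (coeff-*ₚ p _ n) (trans (⋆-distrib-+ʳ _ q r n)
  (sym (trans (coeff-+ₚ (p *ₚ q) _ n) (cong₂ _+ℤ_ (coeff-*ₚ p q n) (coeff-*ₚ p r n)))))

*ₚ-·ₚ-assocˡ : ∀ c p q → (c ·ₚ p) *ₚ q ≋ c ·ₚ (p *ₚ q)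
*ₚ-·ₚ-assocˡ c p q = mk≋ λ n → trans (coeff-*ₚ (c ·ₚ p) q n) (trans (⋆-cong q (coeff-·ₚ c p) n)
  (trans (⋆-scaleˡ c _ q n) (sym (trans (coeff-·ₚ c (p *ₚ q) n) (cong (c *ℤ_) (coeff-*ₚ p q n))))))

*ₚ-·ₚ-assocʳ : ∀ c p q → p *ₚ (c ·ₚ q) ≋ c ·ₚ (p *ₚ q)
*ₚ-·ₚ-assocʳ c p q = mk≋ λ n → trans (coeff-*ₚ p (c ·ₚ q) n) (trans (⋆-scaleʳ c _ q n)
  (sym (trans (coeff-·ₚ c (p *ₚ q) n) (cong (c *ℤ_) (coeff-*ₚ p q n)))))

*ₚ-zeroʳ : ∀ p {q} → q ≋ [] → p *ₚ q ≋ []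
*ₚ-zeroʳ p {q} q≋[] = ≋-trans (*ₚ-congˡ p q≋[]) (mk≋ λ n → trans (coeff-*ₚ p [] n) (⋆-[] (coeff p) n))

0∷-*ₚ : ∀ p q → (+ 0 ∷ p) *ₚ q ≋ + 0 ∷ p *ₚ q
0∷-*ₚ p q = +ₚ-cong {+ 0 ·ₚ q} {[]} (mk≋ λ n → trans (coeff-·ₚ (+ 0) q n) (ℤP.*-zeroˡ (coeff q n))) ≋-refl

*ₚ-∷ : ∀ q a as → q *ₚ (a ∷ as) ≋ a ·ₚ q +ₚ (+ 0 ∷ q *ₚ as)
*ₚ-∷ q a as = mk≋ λ n → trans (coeff-*ₚ q _ n) (trans (⋆-∷ (coeff q) a as n)
  (sym (trans (coeff-+ₚ (a ·ₚ q) _ n) (cong₂ _+ℤ_ (coeff-·ₚ a q n) (shifted n)))))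
  where
  shifted : ∀ n → coeff (+ 0 ∷ q *ₚ as) n ≡ (coeff q ⋆₊ as) n
  shifted zero    = refl
  shifted (suc n) = coeff-*ₚ q as n

*ₚ-comm : ∀ p q → p *ₚ q ≋ q *ₚ p
*ₚ-comm []       q = ≋-sym (*ₚ-zeroʳ q ≋-refl)
*ₚ-comm (a ∷ as) q = ≋-trans (+ₚ-cong (≋-refl {a ·ₚ q}) (∷-cong (+ 0) (*ₚ-comm as q))) (≋-sym (*ₚ-∷ q a as))

*ₚ-assoc : ∀ p q r → (p *ₚ q) *ₚ r ≋ p *ₚ (q *ₚ r)
*ₚ-assoc []       q r = ≋-refl
*ₚ-assoc (a ∷ as) q r = ≋-trans (*ₚ-distribʳ-+ₚ (a ·ₚ q) _ r)
  (+ₚ-cong (*ₚ-·ₚ-assocˡ a q r) (≋-trans (0∷-*ₚ (as *ₚ q) r) (∷-cong (+ 0) (*ₚ-assoc as q r))))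

constₚ-*ₚ : ∀ c q → constₚ c *ₚ q ≋ c ·ₚ q
constₚ-*ₚ c q =
  ≋-trans (+ₚ-cong (≋-refl {c ·ₚ q}) (mk≋ λ { zero → refl ; (suc n) → refl })) (+ₚ-identityʳ (c ·ₚ q))

-- Signs

signℕ-suc-suc : ∀ n → signℕ (suc (suc n)) ≡ signℕ n
signℕ-suc-suc n = ℤP.neg-involutive (signℕ n)

signℕ-double : ∀ n → signℕ (n + n) ≡ + 1
signℕ-double zero    = refl
signℕ-double (suc n) rewrite ℕP.+-suc n n = trans (signℕ-suc-suc (n + n)) (signℕ-double n)

signℕ-+ : ∀ a b → signℕ (a + b) ≡ signℕ a *ℤ signℕ b
signℕ-+ zero    b = sym (ℤP.*-identityˡ _)
signℕ-+ (suc a) b = trans (cong -_ (signℕ-+ a b)) (ℤP.neg-distribˡ-* (signℕ a) (signℕ b))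

signℕ-square : ∀ a → signℕ a *ℤ signℕ a ≡ + 1
signℕ-square a = trans (sym (signℕ-+ a a)) (signℕ-double a)

wt-++ : ∀ u v → wt (u ++ v) ≡ wt u + wt v
wt-++ []          v = refl
wt-++ (true ∷ u)  v = cong suc (wt-++ u v)
wt-++ (false ∷ u) v = wt-++ u v

signℕ-wt-++ : ∀ u v → signℕ (wt (u ++ v)) ≡ signℕ (wt u) *ℤ signℕ (wt v)
signℕ-wt-++ u v = trans (cong signℕ (wt-++ u v)) (signℕ-+ (wt u) (wt v))

bitSign≡signℕ-wt : ∀ b → bitSign b ≡ signℕ (wt [ b ])
bitSign≡signℕ-wt true  = refl
bitSign≡signℕ-wt false = refl

-bitSign-not : ∀ b → (- (+ 1)) *ℤ bitSign (not b) ≡ signℕ (wt [ b ])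
-bitSign-not true  = refl
-bitSign-not false = refl

signℕ-wt-not : ∀ b → signℕ (wt [ not b ]) *ℤ signℕ (wt [ b ]) ≡ - (+ 1)
signℕ-wt-not true  = refl
signℕ-wt-not false = refl

-- Determinants

punchIn-fromℕ : ∀ {n} (k : Fin n) → punchIn (fromℕ n) k ≡ inject₁ k
punchIn-fromℕ fzero    = refl
punchIn-fromℕ (fsuc k) = cong fsuc (punchIn-fromℕ k)

punchIn-inject₁-fromℕ : ∀ {n} (k : Fin (suc n)) → punchIn (inject₁ k) (fromℕ n) ≡ fromℕ (suc n)
punchIn-inject₁-fromℕ         fzero    = refl
punchIn-inject₁-fromℕ {suc n} (fsuc k) = cong fsuc (punchIn-inject₁-fromℕ k)

punchIn-inject₁-inject₁ : ∀ {n} (k : Fin (suc n)) (b : Fin n) → punchIn (inject₁ k) (inject₁ b) ≡ inject₁ (punchIn k b)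
punchIn-inject₁-inject₁ fzero    b        = refl
punchIn-inject₁-inject₁ (fsuc k) fzero    = refl
punchIn-inject₁-inject₁ (fsuc k) (fsuc b) = cong fsuc (punchIn-inject₁-inject₁ k b)

punchIn-inject₁-punchIn-fromℕ : ∀ {n} (k : Fin (suc n)) (b : Fin n) →
  punchIn (inject₁ k) (punchIn (fromℕ n) b) ≡ punchIn (fromℕ (suc n)) (punchIn k b)
punchIn-inject₁-punchIn-fromℕ k b rewrite punchIn-fromℕ b | punchIn-fromℕ (punchIn k b) = punchIn-inject₁-inject₁ k b

toℕ-punchIn-fromℕ : ∀ {n} (b : Fin n) → toℕ (punchIn (fromℕ n) b) ≡ toℕ b
toℕ-punchIn-fromℕ b = trans (cong toℕ (punchIn-fromℕ b)) (FP.toℕ-inject₁ b)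

punchInℕ : ℕ → ℕ → ℕ
punchInℕ zero    a       = suc a
punchInℕ (suc s) zero    = zero
punchInℕ (suc s) (suc a) = suc (punchInℕ s a)

toℕ-punchIn : ∀ {n} (r : Fin (suc n)) (a : Fin n) → toℕ (punchIn r a) ≡ punchInℕ (toℕ r) (toℕ a)
toℕ-punchIn fzero    a        = refl
toℕ-punchIn (fsuc r) fzero    = refl
toℕ-punchIn (fsuc r) (fsuc a) = cong suc (toℕ-punchIn r a)

punchInℕ-< : ∀ s a → a < s → punchInℕ s a ≡ a
punchInℕ-< (suc s) zero    _         = refl
punchInℕ-< (suc s) (suc a) (s≤s a<s) = cong suc (punchInℕ-< s a a<s)

punchInℕ-≥ : ∀ s a → s ≤ a → punchInℕ s a ≡ suc a
punchInℕ-≥ zero    a       _         = refl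
punchInℕ-≥ (suc s) (suc a) (s≤s s≤a) = cong suc (punchInℕ-≥ s a s≤a)

Mat : ℕ → Set
Mat n = Fin n → Fin n → Poly

sumFin-cong : ∀ {n} {f g : Fin n → Poly} → (∀ i → f i ≋ g i) → sumFin f ≋ sumFin g
sumFin-cong {zero}  f≋g = ≋-refl
sumFin-cong {suc n} f≋g = +ₚ-cong (f≋g fzero) (sumFin-cong (f≋g ∘ fsuc))

sumFin-zero : ∀ {n} {f : Fin n → Poly} → (∀ i → f i ≋ []) → sumFin f ≋ []
sumFin-zero {zero}  f≋0 = ≋-refl
sumFin-zero {suc n} f≋0 = +ₚ-cong (f≋0 fzero) (sumFin-zero (f≋0 ∘ fsuc))

sumFin-+ₚ : ∀ {n} (f g : Fin n → Poly) → sumFin (λ i → f i +ₚ g i) ≋ sumFin f +ₚ sumFin g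
sumFin-+ₚ {zero}  f g = ≋-refl
sumFin-+ₚ {suc n} f g = ≋-trans (+ₚ-cong (≋-refl {f fzero +ₚ g fzero}) (sumFin-+ₚ (f ∘ fsuc) (g ∘ fsuc)))
  (+ₚ-interchange (f fzero) (g fzero) (sumFin (f ∘ fsuc)) (sumFin (g ∘ fsuc)))

·ₚ-sumFin : ∀ {n} c (f : Fin n → Poly) → c ·ₚ sumFin f ≋ sumFin (λ i → c ·ₚ f i)
·ₚ-sumFin {zero}  c f = ≋-refl
·ₚ-sumFin {suc n} c f = ≋-trans (·ₚ-distrib-+ₚ c (f fzero) (sumFin (f ∘ fsuc)))
  (+ₚ-cong (≋-refl {c ·ₚ f fzero}) (·ₚ-sumFin c (f ∘ fsuc)))

*ₚ-sumFin : ∀ {n} a (f : Fin n → Poly) → a *ₚ sumFin f ≋ sumFin (λ i → a *ₚ f i)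
*ₚ-sumFin {zero}  a f = *ₚ-zeroʳ a ≋-refl
*ₚ-sumFin {suc n} a f = ≋-trans (*ₚ-distribˡ-+ₚ a (f fzero) (sumFin (f ∘ fsuc)))
  (+ₚ-cong (≋-refl {a *ₚ f fzero}) (*ₚ-sumFin a (f ∘ fsuc)))

sumFin-swap : ∀ {m n} (f : Fin m → Fin n → Poly) →
  sumFin (λ i → sumFin (f i)) ≋ sumFin (λ j → sumFin (λ i → f i j))
sumFin-swap {zero}  {n} f = ≋-sym (sumFin-zero {n} (λ _ → ≋-refl))
sumFin-swap {suc m} {n} f = ≋-trans (+ₚ-cong (≋-refl {sumFin (f fzero)}) (sumFin-swap (f ∘ fsuc)))
  (≋-sym (sumFin-+ₚ (f fzero) (λ j → sumFin (λ i → f (fsuc i) j))))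

sumFin-last : ∀ {n} (f : Fin (suc n) → Poly) → sumFin f ≋ sumFin (f ∘ inject₁) +ₚ f (fromℕ n)
sumFin-last {zero}  f = +ₚ-identityʳ (f fzero)
sumFin-last {suc n} f = ≋-trans (+ₚ-cong (≋-refl {f fzero}) (sumFin-last (f ∘ fsuc)))
  (≋-sym (+ₚ-assoc (f fzero) _ _))

sumFin-single : ∀ {n} (f : Fin n → Poly) (t : Fin n) → (∀ i → i ≢ t → f i ≋ []) → sumFin f ≋ f t
sumFin-single {suc n} f fzero    f≋0 = ≋-trans (+ₚ-cong (≋-refl {f fzero}) (sumFin-zero (λ i → f≋0 (fsuc i) λ ())))
  (+ₚ-identityʳ (f fzero))
sumFin-single {suc n} f (fsuc t) f≋0 = +ₚ-cong (f≋0 fzero λ ())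
  (sumFin-single (f ∘ fsuc) t (λ i i≢t → f≋0 (fsuc i) (i≢t ∘ FP.suc-injective)))

sumFin-swap-nested : ∀ {m n} (c : Fin m → ℤ) (a : Fin m → Poly) (d : Fin n → ℤ) (b : Fin n → Poly)
  (D : Fin m → Fin n → Poly) →
  sumFin (λ k → c k ·ₚ (a k *ₚ sumFin (λ r → d r ·ₚ (b r *ₚ D k r)))) ≋
  sumFin (λ r → d r ·ₚ (b r *ₚ sumFin (λ k → c k ·ₚ (a k *ₚ D k r))))
sumFin-swap-nested {m} {n} c a d b D =
  ≋-trans (sumFin-cong distribute) (≋-trans (sumFin-swap term) (sumFin-cong collect))
  where
  open SetoidReasoning ≋-setoid
  term : Fin m → Fin n → Poly
  term k r = (c k *ℤ d r) ·ₚ (a k *ₚ (b r *ₚ D k r))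
  distribute : ∀ k → c k ·ₚ (a k *ₚ sumFin (λ r → d r ·ₚ (b r *ₚ D k r))) ≋ sumFin (term k)
  distribute k = begin
    c k ·ₚ (a k *ₚ sumFin (λ r → d r ·ₚ (b r *ₚ D k r)))
      ≈⟨ ·ₚ-congˡ (c k) (*ₚ-sumFin (a k) (λ r → d r ·ₚ (b r *ₚ D k r))) ⟩
    c k ·ₚ sumFin (λ r → a k *ₚ (d r ·ₚ (b r *ₚ D k r)))
      ≈⟨ ·ₚ-sumFin (c k) (λ r → a k *ₚ (d r ·ₚ (b r *ₚ D k r))) ⟩
    sumFin (λ r → c k ·ₚ (a k *ₚ (d r ·ₚ (b r *ₚ D k r))))
      ≈⟨ sumFin-cong (λ r → ≋-trans (·ₚ-congˡ (c k) (*ₚ-·ₚ-assocʳ (d r) (a k) _)) (·ₚ-assoc (c k) (d r) _)) ⟩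
    sumFin (term k) ∎
  reorder : ∀ k r → d r ·ₚ (b r *ₚ (c k ·ₚ (a k *ₚ D k r))) ≋ term k r
  reorder k r = begin
    d r ·ₚ (b r *ₚ (c k ·ₚ (a k *ₚ D k r))) ≈⟨ ·ₚ-congˡ (d r) (*ₚ-·ₚ-assocʳ (c k) (b r) _) ⟩
    d r ·ₚ (c k ·ₚ (b r *ₚ (a k *ₚ D k r))) ≈⟨ ·ₚ-assoc (d r) (c k) _ ⟩
    (d r *ℤ c k) ·ₚ (b r *ₚ (a k *ₚ D k r)) ≈⟨ ·ₚ-congʳ _ (ℤP.*-comm (d r) (c k)) ⟩
    (c k *ℤ d r) ·ₚ (b r *ₚ (a k *ₚ D k r))
      ≈⟨ ·ₚ-congˡ _ (≋-trans (≋-sym (*ₚ-assoc (b r) (a k) _))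
           (≋-trans (*ₚ-congʳ _ (*ₚ-comm (b r) (a k))) (*ₚ-assoc (a k) (b r) _))) ⟩
    term k r ∎
  collect : ∀ r → sumFin (λ k → term k r) ≋ d r ·ₚ (b r *ₚ sumFin (λ k → c k ·ₚ (a k *ₚ D k r)))
  collect r = ≋-sym (begin
    d r ·ₚ (b r *ₚ sumFin (λ k → c k ·ₚ (a k *ₚ D k r)))
      ≈⟨ ·ₚ-congˡ (d r) (*ₚ-sumFin (b r) (λ k → c k ·ₚ (a k *ₚ D k r))) ⟩
    d r ·ₚ sumFin (λ k → b r *ₚ (c k ·ₚ (a k *ₚ D k r)))
      ≈⟨ ·ₚ-sumFin (d r) (λ k → b r *ₚ (c k ·ₚ (a k *ₚ D k r))) ⟩
    sumFin (λ k → d r ·ₚ (b r *ₚ (c k ·ₚ (a k *ₚ D k r))))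
      ≈⟨ sumFin-cong (λ k → reorder k r) ⟩
    sumFin (λ k → term k r) ∎)

det-cong : ∀ n {M M′ : Mat n} → (∀ a b → M a b ≋ M′ a b) → det n M ≋ det n M′
det-cong zero    M≋M′ = ≋-refl
det-cong (suc n) M≋M′ = sumFin-cong λ k → ·ₚ-congˡ (signℕ (toℕ k))
  (*ₚ-cong (M≋M′ fzero k) (det-cong n (λ a b → M≋M′ (fsuc a) (punchIn k b))))

det-zeroRow : ∀ n (M : Mat n) (r : Fin n) → (∀ b → M r b ≋ []) → det n M ≋ []
det-zeroRow (suc n) M fzero    row≋0 = sumFin-zero λ k → ·ₚ-congˡ (signℕ (toℕ k))
  (*ₚ-congʳ (det n (λ a b → M (fsuc a) (punchIn k b))) (row≋0 k))
det-zeroRow (suc n) M (fsuc r) row≋0 = sumFin-zero λ k → ·ₚ-congˡ (signℕ (toℕ k))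
  (*ₚ-zeroʳ (M fzero k) (det-zeroRow n (λ a b → M (fsuc a) (punchIn k b)) r (row≋0 ∘ punchIn k)))

-- Expand the first row, expand each of its minors along their last column, and exchange the sums.
det-lastColumn : ∀ n (M : Mat (suc n)) → det (suc n) M ≋
  sumFin (λ r → signℕ (n + toℕ r) ·ₚ (M r (fromℕ n) *ₚ det n (λ a b → M (punchIn r a) (punchIn (fromℕ n) b))))
det-lastColumn zero    M = ≋-refl
det-lastColumn (suc n) M = begin
    det (suc (suc n)) M                        ≈⟨ sumFin-last F ⟩
    sumFin (F ∘ inject₁) +ₚ F (fromℕ (suc n))  ≈⟨ +ₚ-comm (sumFin (F ∘ inject₁)) _ ⟩
    F (fromℕ (suc n)) +ₚ sumFin (F ∘ inject₁)  ≈⟨ +ₚ-cong lastTerm otherTerms ⟩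
    G fzero +ₚ sumFin (G ∘ fsuc)               ∎
  where
  open SetoidReasoning ≋-setoid
  F G : Fin (suc (suc n)) → Poly
  F k = signℕ (toℕ k) ·ₚ (M fzero k *ₚ det (suc n) (λ a b → M (fsuc a) (punchIn k b)))
  G r = signℕ (suc n + toℕ r) ·ₚ
    (M r (fromℕ (suc n)) *ₚ det (suc n) (λ a b → M (punchIn r a) (punchIn (fromℕ (suc n)) b)))
  lastTerm : F (fromℕ (suc n)) ≋ G fzero
  lastTerm = ·ₚ-congʳ _ (cong signℕ (trans (FP.toℕ-fromℕ (suc n)) (sym (ℕP.+-identityʳ (suc n)))))
  c : Fin (suc n) → ℤ
  c k = signℕ (toℕ k)
  a : Fin (suc n) → Poly
  a k = M fzero (inject₁ k)
  d : Fin (suc n) → ℤ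
  d r = signℕ (n + toℕ r)
  b : Fin (suc n) → Poly
  b r = M (fsuc r) (fromℕ (suc n))
  D : Fin (suc n) → Fin (suc n) → Poly
  D k r = det n (λ x y → M (fsuc (punchIn r x)) (punchIn (fromℕ (suc n)) (punchIn k y)))
  expandMinor : ∀ k → F (inject₁ k) ≋ c k ·ₚ (a k *ₚ sumFin (λ r → d r ·ₚ (b r *ₚ D k r)))
  expandMinor k = ≋-trans (·ₚ-congʳ _ (cong signℕ (FP.toℕ-inject₁ k)))
    (·ₚ-congˡ (c k) (*ₚ-congˡ (a k) (≋-trans (det-lastColumn n (λ x y → M (fsuc x) (punchIn (inject₁ k) y)))
      (sumFin-cong λ r → ·ₚ-congˡ (d r) (*ₚ-cong (≡⇒≋ (cong (M (fsuc r)) (punchIn-inject₁-fromℕ k)))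
         (det-cong n (λ x y → ≡⇒≋ (cong (M (fsuc (punchIn r x))) (punchIn-inject₁-punchIn-fromℕ k y)))))))))
  contractMinor : ∀ r → d r ·ₚ (b r *ₚ sumFin (λ k → c k ·ₚ (a k *ₚ D k r))) ≋ G (fsuc r)
  contractMinor r = ≋-trans
    (·ₚ-congʳ _ (trans (sym (signℕ-suc-suc (n + toℕ r)))
      (cong (signℕ ∘ suc) (sym (ℕP.+-suc n (toℕ r))))))
    (·ₚ-congˡ _ (*ₚ-congˡ (b r) (sumFin-cong λ k → ·ₚ-congˡ (c k)
      (*ₚ-congʳ (D k r) (≡⇒≋ (cong (M fzero) (sym (punchIn-fromℕ k))))))))
  otherTerms : sumFin (F ∘ inject₁) ≋ sumFin (G ∘ fsuc)
  otherTerms =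
    ≋-trans (sumFin-cong expandMinor) (≋-trans (sumFin-swap-nested c a d b D) (sumFin-cong contractMinor))

-- Lists and bit strings

≡ᵇ-refl : ∀ n → (n ≡ᵇ n) ≡ true
≡ᵇ-refl n = Equivalence.to BoolP.T-≡ (ℕP.≡⇒≡ᵇ n n refl)

≡ᵇ≡true⇒≡ : ∀ m n → (m ≡ᵇ n) ≡ true → m ≡ n
≡ᵇ≡true⇒≡ m n = ℕP.≡ᵇ⇒≡ m n ∘ Equivalence.from BoolP.T-≡

≢⇒≡ᵇ≡false : ∀ {m n} → m ≢ n → (m ≡ᵇ n) ≡ false
≢⇒≡ᵇ≡false {m} {n} m≢n = BoolP.¬-not (m≢n ∘ ≡ᵇ≡true⇒≡ m n)

≟L-refl : ∀ u → (u ≟L u) ≡ true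
≟L-refl u = dec-true (≡-dec BoolP._≟_ u u) refl

≟L≡true⇒≡ : ∀ u v → (u ≟L v) ≡ true → u ≡ v
≟L≡true⇒≡ u v u≟v with ≡-dec BoolP._≟_ u v | u≟v
... | yes u≡v | _  = u≡v
... | no _    | ()

length-take≤ : ∀ i (p : List Bool) → i ≤ length p → length (take i p) ≡ i
length-take≤ i p i≤ = trans (length-take i p) (ℕP.m≤n⇒m⊓n≡m i≤)

take-take≤ : ∀ a i (p : List Bool) → a ≤ i → take a (take i p) ≡ take a p
take-take≤ a i p a≤i = trans (take-take a i p) (cong (λ z → take z p) (ℕP.m≤n⇒m⊓n≡m a≤i))

length-∷ʳ : ∀ (u : List Bool) c → length (u ++ [ c ]) ≡ suc (length u)
length-∷ʳ u c = trans (length-++ u) (ℕP.+-comm (length u) 1)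

drop-++ˡ : ∀ k (a c : List Bool) → k ≤ length a → drop k (a ++ c) ≡ drop k a ++ c
drop-++ˡ zero    a       c _       = refl
drop-++ˡ (suc k) (x ∷ a) c (s≤s k≤) = drop-++ˡ k a c k≤

take-suc-at : ∀ (p : List Bool) i → i < length p → take (suc i) p ≡ take i p ++ [ at p (suc i) ]
take-suc-at (x ∷ p) zero    _         = refl
take-suc-at (x ∷ p) (suc i) (s≤s i<∣p∣) = cong (x ∷_) (take-suc-at p i i<∣p∣)

at-drop : ∀ (p : List Bool) s t → at (drop s p) (suc t) ≡ at p (suc (s + t))
at-drop p       zero    t = refl
at-drop []      (suc s) t = refl
at-drop (x ∷ p) (suc s) t = at-drop p s t

∷ʳ-at-last : ∀ p n → length p ≡ suc n → p ≡ take n p ++ [ at p (suc n) ]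
∷ʳ-at-last p n ∣p∣≡ = trans (sym (take-all (suc n) p (ℕP.≤-reflexive ∣p∣≡)))
  (take-suc-at p n (subst (n <_) (sym ∣p∣≡) (ℕP.n<1+n n)))

drop-∷ʳ-last : ∀ p s t → length p ≡ suc (s + t) → drop s p ≡ take t (drop s p) ++ [ at p (suc (s + t)) ]
drop-∷ʳ-last p s t ∣p∣≡ = trans (sym (take-all (suc t) (drop s p) (ℕP.≤-reflexive ∣drop∣≡)))
  (trans (take-suc-at (drop s p) t (subst (t <_) (sym ∣drop∣≡) (ℕP.n<1+n t)))
    (cong (λ b → take t (drop s p) ++ [ b ]) (at-drop p s t)))
  where
  ∣drop∣≡ : length (drop s p) ≡ suc t
  ∣drop∣≡ = trans (length-drop s p) (trans (cong (_∸ s) ∣p∣≡)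
    (trans (ℕP.+-∸-assoc 1 (ℕP.m≤m+n s t)) (cong suc (ℕP.m+n∸m≡n s t))))

-- The KMP automaton

border-≤ : ∀ u w L → border u w L ≤ L
border-≤ u w zero    = z≤n
border-≤ u w (suc L) with drop (length u ∸ suc L) u ≟L take (suc L) w
... | true  = ℕP.≤-refl
... | false = ℕP.m≤n⇒m≤1+n (border-≤ u w L)

border-sound : ∀ u w B L → border u w B ≡ suc L → drop (length u ∸ suc L) u ≡ take (suc L) w
border-sound u w (suc B) L border≡ with drop (length u ∸ suc B) u ≟L take (suc B) w in match
... | true with refl ← border≡ = ≟L≡true⇒≡ _ _ match
... | false = border-sound u w B L border≡

border-top : ∀ u w L → drop (length u ∸ suc L) u ≡ take (suc L) w → border u w (suc L) ≡ suc L
border-top u w L match rewrite match | ≟L-refl (take (suc L) w) = refl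

border-take : ∀ u i (p : List Bool) L → L ≤ i → border u (take i p) L ≡ border u p L
border-take u i p zero    _   = refl
border-take u i p (suc L) L≤i rewrite take-take≤ (suc L) i p L≤i | border-take u i p L (ℕP.<⇒≤ L≤i) = refl

δ-≤ : ∀ w s c → δ w s c ≤ suc s
δ-≤ w s c with s ≡ᵇ length w in accepting
... | true rewrite ≡ᵇ≡true⇒≡ s (length w) accepting = ℕP.n≤1+n _
... | false = border-≤ _ w (suc s)

δ-border : ∀ w s c → s < length w → δ w s c ≡ border (take s w ++ [ c ]) w (suc s)
δ-border w s c s<∣w∣ rewrite ≢⇒≡ᵇ≡false (ℕP.<⇒≢ s<∣w∣) = refl

δ-take : ∀ p i s c → s < i → i ≤ length p → δ (take i p) s c ≡ δ p s c
δ-take p i s c s<i i≤∣p∣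
  rewrite δ-border (take i p) s c (subst (s <_) (sym (length-take≤ i p i≤∣p∣)) s<i)
        | δ-border p s c (ℕP.<-≤-trans s<i i≤∣p∣)
        | take-take≤ s i p (ℕP.<⇒≤ s<i) = border-take _ i p (suc s) s<i

drop-window : ∀ (p : List Bool) i c → i ≤ length p →
  drop (length (take i p ++ [ c ]) ∸ suc i) (take i p ++ [ c ]) ≡ take i p ++ [ c ]
drop-window p i c i≤∣p∣ rewrite length-∷ʳ (take i p) c | length-take≤ i p i≤∣p∣ | ℕP.n∸n≡0 i = refl

δ-match : ∀ p i → i < length p → δ p i (at p (suc i)) ≡ suc i
δ-match p i i<∣p∣ rewrite δ-border p i (at p (suc i)) i<∣p∣ =
  border-top _ p i (trans (drop-window p i _ (ℕP.<⇒≤ i<∣p∣)) (sym (take-suc-at p i i<∣p∣)))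

δ-mismatch : ∀ p i → i < length p → δ p i (not (at p (suc i))) ≢ suc i
δ-mismatch p i i<∣p∣ δ≡ rewrite δ-border p i (not (at p (suc i))) i<∣p∣ =
  BoolP.not-¬ refl (sym (∷ʳ-injectiveʳ (take i p) (take i p) same))
  where
  same : take i p ++ [ not (at p (suc i)) ] ≡ take i p ++ [ at p (suc i) ]
  same = trans (sym (drop-window p i _ (ℕP.<⇒≤ i<∣p∣)))
    (trans (border-sound _ p (suc i) i δ≡) (take-suc-at p i i<∣p∣))

mismatch-border : ∀ p n s t → length p ≡ suc n → s + t ≡ n → 1 ≤ s → δ p n (not (at p (suc n))) ≡ s →
  take s p ≡ drop (suc t) (take n p) ++ [ not (at p (suc n)) ]
mismatch-border p n (suc L) t ∣p∣≡ s+t≡n _ δ≡s = begin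
  take (suc L) p                          ≡⟨ sym (border-sound u p (suc n) L (trans (sym (δ-border p n _ n<∣p∣)) δ≡s)) ⟩
  drop (length u ∸ suc L) u               ≡⟨ cong (λ i → drop i u) ∣u∣-s≡ ⟩
  drop (suc t) u                          ≡⟨ drop-++ˡ (suc t) (take n p) _ t+1≤n ⟩
  drop (suc t) (take n p) ++ [ not b ]    ∎
  where
  open ≡-Reasoning
  b : Bool
  b = at p (suc n)
  u : List Bool
  u = take n p ++ [ not b ]
  n<∣p∣ : n < length p
  n<∣p∣ = subst (n <_) (sym ∣p∣≡) (ℕP.n<1+n n)
  ∣take∣≡ : length (take n p) ≡ n
  ∣take∣≡ = length-take≤ n p (ℕP.<⇒≤ n<∣p∣)
  ∣u∣-s≡ : length u ∸ suc L ≡ suc t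
  ∣u∣-s≡ = trans (cong (_∸ suc L) (trans (length-∷ʳ (take n p) (not b)) (cong suc (trans ∣take∣≡ (sym s+t≡n)))))
    (trans (ℕP.+-∸-assoc 1 (ℕP.m≤m+n (suc L) t)) (cong suc (ℕP.m+n∸m≡n (suc L) t)))
  t+1≤n : suc t ≤ length (take n p)
  t+1≤n = subst (suc t ≤_) (trans s+t≡n (sym ∣take∣≡)) (s≤s (ℕP.m≤n+m t L))

-- The matrix λI - T_p

-- the (j, i) entry of λI - T_w on 0-based natural-number indices;
-- charMat w j i = charEntry w (toℕ j) (toℕ i) holds by definition
charEntry : List Bool → ℕ → ℕ → Poly
charEntry w j i = (if j ≡ᵇ i then X else []) -ₚ constₚ
  ((if δ w i false ≡ᵇ j then bitSign false else + 0) +ℤ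
   (if δ w i true  ≡ᵇ j then bitSign true  else + 0))

detℕ : ℕ → (ℕ → ℕ → Poly) → Poly
detℕ n f = det n (λ a b → f (toℕ a) (toℕ b))

detℕ-cong : ∀ n {f g : ℕ → ℕ → Poly} → (∀ a b → a < n → b < n → f a b ≋ g a b) → detℕ n f ≋ detℕ n g
detℕ-cong n f≋g = det-cong n (λ a b → f≋g (toℕ a) (toℕ b) (FP.toℕ<n a) (FP.toℕ<n b))

charEntry-take : ∀ p i j s → s < i → i ≤ length p → charEntry (take i p) j s ≡ charEntry p j s
charEntry-take p i j s s<i i≤∣p∣ rewrite δ-take p i s false s<i i≤∣p∣ | δ-take p i s true s<i i≤∣p∣ = refl

P-leading : ∀ p i → i ≤ length p → P p i ≋ detℕ i (charEntry p)
P-leading p i i≤∣p∣ = ≋-trans (≡⇒≋ (cong (λ n → detℕ n (charEntry (take i p))) (length-take≤ i p i≤∣p∣)))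
  (detℕ-cong i (λ a b _ b<i → ≡⇒≋ (charEntry-take p i a b b<i i≤∣p∣)))

·ₚ-P-zero : ∀ c p → c ·ₚ P p 0 ≋ constₚ c
·ₚ-P-zero c p = mk≋ λ { zero → ℤP.*-identityʳ c ; (suc _) → refl }

charEntry-Hessenberg : ∀ p j i → suc i < j → charEntry p j i ≋ []
charEntry-Hessenberg p j i i+1<j
  rewrite ≢⇒≡ᵇ≡false (≢-sym (ℕP.<⇒≢ (ℕP.<-trans (ℕP.n<1+n i) i+1<j)))
        | ≢⇒≡ᵇ≡false (ℕP.<⇒≢ (ℕP.≤-<-trans (δ-≤ p i false) i+1<j))
        | ≢⇒≡ᵇ≡false (ℕP.<⇒≢ (ℕP.≤-<-trans (δ-≤ p i true) i+1<j)) = mk≋ λ { zero → refl ; (suc n) → refl }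

charEntry-subdiagonal : ∀ p i → i < length p → charEntry p (suc i) i ≋ constₚ (- bitSign (at p (suc i)))
charEntry-subdiagonal p i i<∣p∣ with at p (suc i) | δ-match p i i<∣p∣ | δ-mismatch p i i<∣p∣
... | false | match | mismatch rewrite ≢⇒≡ᵇ≡false (ℕP.1+n≢n {i}) | match | ≡ᵇ-refl i | ≢⇒≡ᵇ≡false mismatch =
  mk≋ λ { zero → refl ; (suc n) → refl }
... | true  | match | mismatch rewrite ≢⇒≡ᵇ≡false (ℕP.1+n≢n {i}) | match | ≡ᵇ-refl i | ≢⇒≡ᵇ≡false mismatch =
  mk≋ λ { zero → refl ; (suc n) → refl }

-- from q_{n+1} the letter p[n+1] leads to the accepting state, which has no row
charEntry-lastColumn : ∀ p n s j → length p ≡ suc n → δ p n (not (at p (suc n))) ≡ s → j ≤ n →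
  charEntry p j n ≡
    (if j ≡ᵇ n then X else []) -ₚ constₚ (if s ≡ᵇ j then bitSign (not (at p (suc n))) else + 0)
charEntry-lastColumn p n s j ∣p∣≡ δ≡s j≤n
  with at p (suc n) | δ-match p n (subst (n <_) (sym ∣p∣≡) (ℕP.n<1+n n))
... | false | match rewrite match | δ≡s | ≢⇒≡ᵇ≡false (≢-sym (ℕP.<⇒≢ (s≤s j≤n))) =
  cong (λ c → (if j ≡ᵇ n then X else []) -ₚ constₚ c) (ℤP.+-identityˡ _)
... | true  | match rewrite match | δ≡s | ≢⇒≡ᵇ≡false (≢-sym (ℕP.<⇒≢ (s≤s j≤n))) =
  cong (λ c → (if j ≡ᵇ n then X else []) -ₚ constₚ c) (ℤP.+-identityʳ _)

-- the product of the subdiagonal entries of λI - T_p in columns s, …, s + t - 1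
subdiagonalProduct : List Bool → ℕ → ℕ → ℤ
subdiagonalProduct p s zero    = + 1
subdiagonalProduct p s (suc t) = subdiagonalProduct p s t *ℤ (- bitSign (at p (suc (s + t))))

-- Deleting row s from the leading (s+t+1)-minor of the Hessenberg matrix leaves a block lower triangular one.
det-deleteRow : ∀ p s t → s + t < length p →
  detℕ (s + t) (λ a b → charEntry p (punchInℕ s a) b) ≋ subdiagonalProduct p s t ·ₚ detℕ s (charEntry p)
det-deleteRow p s zero _ =
  ≋-trans (≡⇒≋ (cong (λ n → detℕ n (λ a b → charEntry p (punchInℕ s a) b)) (ℕP.+-identityʳ s)))
  (≋-trans (detℕ-cong s (λ a b a<s _ → ≡⇒≋ (cong (λ j → charEntry p j b) (punchInℕ-< s a a<s))))
    (≋-sym (·ₚ-identityˡ _)))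
det-deleteRow p s (suc t) s+t+1<∣p∣ =
  ≋-trans (≡⇒≋ (cong (λ n → detℕ n f) (ℕP.+-suc s t)))
    (≋-trans (det-lastColumn N M) (≋-trans (sumFin-single G (fromℕ N) otherRowsVanish) lastRow))
  where
  open SetoidReasoning ≋-setoid
  N : ℕ
  N = s + t
  f : ℕ → ℕ → Poly
  f a b = charEntry p (punchInℕ s a) b
  M : Mat (suc N)
  M a b = f (toℕ a) (toℕ b)
  G : Fin (suc N) → Poly
  G r = signℕ (N + toℕ r) ·ₚ (M r (fromℕ N) *ₚ det N (λ a b → M (punchIn r a) (punchIn (fromℕ N) b)))
  N+1<∣p∣ : suc N < length p
  N+1<∣p∣ = subst (_< length p) (ℕP.+-suc s t) s+t+1<∣p∣
  N<∣p∣ : N < length p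
  N<∣p∣ = ℕP.<-trans (ℕP.n<1+n N) N+1<∣p∣
  lastRowIndex : punchInℕ s (toℕ (fromℕ N)) ≡ suc N
  lastRowIndex = trans (cong (punchInℕ s) (FP.toℕ-fromℕ N)) (punchInℕ-≥ s N (ℕP.m≤m+n s t))
  lastRowOfMinor≋0 : ∀ r (r≢N : r ≢ fromℕ N) b → M (punchIn r (punchOut r≢N)) (punchIn (fromℕ N) b) ≋ []
  lastRowOfMinor≋0 r r≢N b rewrite FP.punchIn-punchOut r≢N | lastRowIndex | toℕ-punchIn-fromℕ b =
    charEntry-Hessenberg p (suc N) (toℕ b) (s≤s (FP.toℕ<n b))
  otherRowsVanish : ∀ r → r ≢ fromℕ N → G r ≋ []
  otherRowsVanish r r≢N =
    ·ₚ-congˡ _ (*ₚ-zeroʳ (M r (fromℕ N)) (det-zeroRow N _ (punchOut r≢N) (lastRowOfMinor≋0 r r≢N)))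
  β : ℤ
  β = - bitSign (at p (suc N))
  lastRow : G (fromℕ N) ≋ subdiagonalProduct p s (suc t) ·ₚ detℕ s (charEntry p)
  lastRow = begin
    G (fromℕ N)
      ≈⟨ ·ₚ-congʳ _ (trans (cong (λ z → signℕ (N + z)) (FP.toℕ-fromℕ N)) (signℕ-double N)) ⟩
    + 1 ·ₚ (M (fromℕ N) (fromℕ N) *ₚ det N (λ a b → M (punchIn (fromℕ N) a) (punchIn (fromℕ N) b)))
      ≈⟨ ·ₚ-identityˡ _ ⟩
    M (fromℕ N) (fromℕ N) *ₚ det N (λ a b → M (punchIn (fromℕ N) a) (punchIn (fromℕ N) b))
      ≈⟨ *ₚ-cong (≡⇒≋ (cong₂ (charEntry p) lastRowIndex (FP.toℕ-fromℕ N)))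
                 (det-cong N (λ a b → ≡⇒≋ (cong₂ f (toℕ-punchIn-fromℕ a) (toℕ-punchIn-fromℕ b)))) ⟩
    charEntry p (suc N) N *ₚ detℕ N f
      ≈⟨ *ₚ-cong (charEntry-subdiagonal p N N<∣p∣) (det-deleteRow p s t N<∣p∣) ⟩
    constₚ β *ₚ (subdiagonalProduct p s t ·ₚ detℕ s (charEntry p))
      ≈⟨ constₚ-*ₚ β _ ⟩
    β ·ₚ (subdiagonalProduct p s t ·ₚ detℕ s (charEntry p))
      ≈⟨ ·ₚ-assoc β (subdiagonalProduct p s t) _ ⟩
    (β *ℤ subdiagonalProduct p s t) ·ₚ detℕ s (charEntry p)
      ≈⟨ ·ₚ-congʳ _ (ℤP.*-comm β (subdiagonalProduct p s t)) ⟩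
    subdiagonalProduct p s (suc t) ·ₚ detℕ s (charEntry p) ∎

lastColumnCoefficient : List Bool → ℕ → ℕ → ℕ → ℤ
lastColumnCoefficient p n s t =
  signℕ (n + s) *ℤ (((- (+ 1)) *ℤ bitSign (not (at p (suc n)))) *ℤ subdiagonalProduct p s t)

-- The last column of λI - T_p has only two non-zero entries.
P-lastColumn : ∀ p n s t → length p ≡ suc n → s + t ≡ n → δ p n (not (at p (suc n))) ≡ s →
  P p (suc n) ≋ X *ₚ P p n +ₚ lastColumnCoefficient p n s t ·ₚ P p s
P-lastColumn p n s t ∣p∣≡ s+t≡n δ≡s = begin
    P p (suc n)                          ≈⟨ P-leading p (suc n) (ℕP.≤-reflexive (sym ∣p∣≡)) ⟩
    detℕ (suc n) (charEntry p)           ≈⟨ det-lastColumn n M ⟩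
    sumFin G                             ≈⟨ sumFin-cong split ⟩
    sumFin (λ r → G₁ r +ₚ G₂ r)          ≈⟨ sumFin-+ₚ G₁ G₂ ⟩
    sumFin G₁ +ₚ sumFin G₂               ≈⟨ +ₚ-cong (≋-trans (sumFin-single G₁ (fromℕ n) G₁-vanish) diagonalTerm)
                                                   (≋-trans (sumFin-single G₂ row-s G₂-vanish) row-sTerm) ⟩
    X *ₚ P p n +ₚ lastColumnCoefficient p n s t ·ₚ P p s ∎
  where
  open SetoidReasoning ≋-setoid
  β : ℤ
  β = bitSign (not (at p (suc n)))
  M : Mat (suc n)
  M a c = charEntry p (toℕ a) (toℕ c)
  D : Fin (suc n) → Poly
  D r = det n (λ a c → M (punchIn r a) (punchIn (fromℕ n) c))
  diagonalPart row-sPart : Fin (suc n) → Poly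
  diagonalPart r = if toℕ r ≡ᵇ n then X else []
  row-sPart    r = -ₚ constₚ (if s ≡ᵇ toℕ r then β else + 0)
  G G₁ G₂ : Fin (suc n) → Poly
  G  r = signℕ (n + toℕ r) ·ₚ (M r (fromℕ n) *ₚ D r)
  G₁ r = signℕ (n + toℕ r) ·ₚ (diagonalPart r *ₚ D r)
  G₂ r = signℕ (n + toℕ r) ·ₚ (row-sPart r *ₚ D r)
  lastColumnEntry : ∀ r → M r (fromℕ n) ≡ diagonalPart r +ₚ row-sPart r
  lastColumnEntry r rewrite FP.toℕ-fromℕ n = charEntry-lastColumn p n s (toℕ r) ∣p∣≡ δ≡s (ℕP.≤-pred (FP.toℕ<n r))
  split : ∀ r → G r ≋ G₁ r +ₚ G₂ r
  split r = ≋-trans (·ₚ-congˡ _ (≋-trans (*ₚ-congʳ (D r) (≡⇒≋ (lastColumnEntry r)))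
                                          (*ₚ-distribʳ-+ₚ (diagonalPart r) (row-sPart r) (D r))))
    (·ₚ-distrib-+ₚ _ (diagonalPart r *ₚ D r) (row-sPart r *ₚ D r))
  G₁-vanish : ∀ r → r ≢ fromℕ n → G₁ r ≋ []
  G₁-vanish r r≢n rewrite ≢⇒≡ᵇ≡false (λ r≡n → r≢n (FP.toℕ-injective (trans r≡n (sym (FP.toℕ-fromℕ n))))) = ≋-refl
  diagonalTerm : G₁ (fromℕ n) ≋ X *ₚ P p n
  diagonalTerm rewrite FP.toℕ-fromℕ n | ≡ᵇ-refl n | signℕ-double n =
    ≋-trans (·ₚ-identityˡ _) (*ₚ-congˡ X (≋-trans
      (det-cong n (λ a c → ≡⇒≋ (cong₂ (charEntry p) (toℕ-punchIn-fromℕ a) (toℕ-punchIn-fromℕ c))))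
      (≋-sym (P-leading p n (subst (n ≤_) (sym ∣p∣≡) (ℕP.n≤1+n n))))))
  s<n+1 : s < suc n
  s<n+1 = s≤s (subst (s ≤_) s+t≡n (ℕP.m≤m+n s t))
  row-s : Fin (suc n)
  row-s = fromℕ< s<n+1
  G₂-vanish : ∀ r → r ≢ row-s → G₂ r ≋ []
  G₂-vanish r r≢s
    rewrite ≢⇒≡ᵇ≡false (λ s≡r → r≢s (FP.toℕ-injective (trans (sym s≡r) (sym (FP.toℕ-fromℕ< s<n+1))))) =
    ·ₚ-congˡ _ (*ₚ-congʳ { -ₚ constₚ (+ 0)} {[]} (D r) (mk≋ λ { zero → refl ; (suc k) → refl }))
  D-row-s : D row-s ≋ subdiagonalProduct p s t ·ₚ P p s
  D-row-s = ≋-trans (det-cong n (λ a c → ≡⇒≋ (cong₂ (charEntry p)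
      (trans (toℕ-punchIn row-s a) (cong (λ z → punchInℕ z (toℕ a)) (FP.toℕ-fromℕ< s<n+1))) (toℕ-punchIn-fromℕ c))))
    (≋-trans (≡⇒≋ (cong (λ z → detℕ z (λ a c → charEntry p (punchInℕ s a) c)) (sym s+t≡n)))
    (≋-trans (det-deleteRow p s t (subst (_< length p) (sym s+t≡n) (subst (n <_) (sym ∣p∣≡) (ℕP.n<1+n n))))
      (·ₚ-congˡ _ (≋-sym (P-leading p s (ℕP.≤-trans (ℕP.<⇒≤ s<n+1) (ℕP.≤-reflexive (sym ∣p∣≡))))))))
  row-sTerm : G₂ row-s ≋ lastColumnCoefficient p n s t ·ₚ P p s
  row-sTerm rewrite FP.toℕ-fromℕ< s<n+1 | ≡ᵇ-refl s =
    ≋-trans (·ₚ-congˡ _ (≋-trans (constₚ-*ₚ ((- (+ 1)) *ℤ β) (D row-s))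
                                 (≋-trans (·ₚ-congˡ _ D-row-s) (·ₚ-assoc _ _ _))))
      (·ₚ-assoc _ _ _)

-- The sign of the border term

subdiagonalProduct≡ : ∀ p s t → s + t ≤ length p →
  subdiagonalProduct p s t ≡ signℕ t *ℤ signℕ (wt (take t (drop s p)))
subdiagonalProduct≡ p s zero    _ = refl
subdiagonalProduct≡ p s (suc t) s+t+1≤∣p∣
  rewrite take-suc-at (drop s p) t (subst (t <_) (sym (length-drop s p))
            (ℕP.m+n≤o⇒m≤o∸n (suc t) (subst (_≤ length p) (ℕP.+-comm s (suc t)) s+t+1≤∣p∣)))
        | signℕ-wt-++ (take t (drop s p)) [ at (drop s p) (suc t) ] | at-drop p s t
        | subdiagonalProduct≡ p s t (ℕP.≤-trans (ℕP.+-monoʳ-≤ s (ℕP.n≤1+n t)) s+t+1≤∣p∣)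
        | bitSign≡signℕ-wt (at p (suc (s + t))) =
  shuffle (signℕ t) (signℕ (wt (take t (drop s p)))) (signℕ (wt [ at p (suc (s + t)) ]))
  where
  shuffle : ∀ a w y → a *ℤ w *ℤ (- y) ≡ (- a) *ℤ (w *ℤ y)
  shuffle = solve-∀

lastColumnCoefficient≡ : ∀ p s t → length p ≡ suc (s + t) →
  lastColumnCoefficient p (s + t) s t ≡ signℕ (wt (drop s p))
lastColumnCoefficient≡ p s t ∣p∣≡ = begin
  signℕ (s + t + s) *ℤ (((- (+ 1)) *ℤ bitSign (not b)) *ℤ subdiagonalProduct p s t)
    ≡⟨ cong₂ (λ σ y → σ *ℤ (y *ℤ subdiagonalProduct p s t))
         (trans (signℕ-+ (s + t) s) (cong (_*ℤ signℕ s) (signℕ-+ s t))) (-bitSign-not b) ⟩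
  signℕ s *ℤ signℕ t *ℤ signℕ s *ℤ (y *ℤ subdiagonalProduct p s t)
    ≡⟨ cong (λ π → signℕ s *ℤ signℕ t *ℤ signℕ s *ℤ (y *ℤ π))
         (subdiagonalProduct≡ p s t (ℕP.≤-trans (ℕP.n≤1+n _) (ℕP.≤-reflexive (sym ∣p∣≡)))) ⟩
  signℕ s *ℤ signℕ t *ℤ signℕ s *ℤ (y *ℤ (signℕ t *ℤ w))
    ≡⟨ shuffle (signℕ s) (signℕ t) w y ⟩
  (signℕ s *ℤ signℕ s) *ℤ (signℕ t *ℤ signℕ t) *ℤ (w *ℤ y)
    ≡⟨ cong₂ (λ u v → u *ℤ v *ℤ (w *ℤ y)) (signℕ-square s) (signℕ-square t) ⟩
  + 1 *ℤ + 1 *ℤ (w *ℤ y)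
    ≡⟨ ℤP.*-identityˡ (w *ℤ y) ⟩
  w *ℤ y
    ≡⟨ sym (trans (cong (signℕ ∘ wt) (drop-∷ʳ-last p s t ∣p∣≡)) (signℕ-wt-++ (take t (drop s p)) [ b ])) ⟩
  signℕ (wt (drop s p)) ∎
  where
  open ≡-Reasoning
  b : Bool
  b = at p (suc (s + t))
  y w : ℤ
  y = signℕ (wt [ b ])
  w = signℕ (wt (take t (drop s p)))
  shuffle : ∀ a c w y → a *ℤ c *ℤ a *ℤ (y *ℤ (c *ℤ w)) ≡ (a *ℤ a) *ℤ (c *ℤ c) *ℤ (w *ℤ y)
  shuffle = solve-∀

-- wt p splits both at k and at s, and p[1..s], p[k+1..m] differ only in their last letter.
signℕ-wt-drop-mismatch : ∀ p n s t → length p ≡ suc n → s + t ≡ n → 1 ≤ s → δ p n (not (at p (suc n))) ≡ s →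
  signℕ (wt (drop s p)) ≡ (- (+ 1)) *ℤ signℕ (wt (take (suc t) p))
signℕ-wt-drop-mismatch p n s t ∣p∣≡ s+t≡n 1≤s δ≡s = begin
  Ds                                 ≡⟨ sym (ℤP.*-identityˡ Ds) ⟩
  + 1 *ℤ Ds                          ≡⟨ cong (_*ℤ Ds) (sym (signℕ-square (wt (take s p)))) ⟩
  Ts *ℤ Ts *ℤ Ds                     ≡⟨ ℤP.*-assoc Ts Ts Ds ⟩
  Ts *ℤ (Ts *ℤ Ds)                   ≡⟨ cong (Ts *ℤ_) (sym both-splits) ⟩
  Ts *ℤ (Tk *ℤ Dk)                   ≡⟨ cong₂ (λ a d → a *ℤ (Tk *ℤ d)) Ts≡ Dk≡ ⟩
  Mid *ℤ yn *ℤ (Tk *ℤ (Mid *ℤ yb))   ≡⟨ shuffle Mid yn yb Tk ⟩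
  Mid *ℤ Mid *ℤ (yn *ℤ yb) *ℤ Tk     ≡⟨ cong₂ (λ v w → v *ℤ w *ℤ Tk) (signℕ-square (wt mid)) (signℕ-wt-not b) ⟩
  + 1 *ℤ (- (+ 1)) *ℤ Tk             ≡⟨⟩
  (- (+ 1)) *ℤ Tk                    ∎
  where
  open ≡-Reasoning
  b : Bool
  b = at p (suc n)
  mid : List Bool
  mid = drop (suc t) (take n p)
  Tk Dk Ts Ds Mid yb yn : ℤ
  Tk = signℕ (wt (take (suc t) p))
  Dk = signℕ (wt (drop (suc t) p))
  Ts = signℕ (wt (take s p))
  Ds = signℕ (wt (drop s p))
  Mid = signℕ (wt mid)
  yb = signℕ (wt [ b ])
  yn = signℕ (wt [ not b ])
  signℕ-wt-split : ∀ i → signℕ (wt p) ≡ signℕ (wt (take i p)) *ℤ signℕ (wt (drop i p))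
  signℕ-wt-split i = trans (cong (signℕ ∘ wt) (sym (take++drop≡id i p))) (signℕ-wt-++ (take i p) (drop i p))
  both-splits : Tk *ℤ Dk ≡ Ts *ℤ Ds
  both-splits = trans (sym (signℕ-wt-split (suc t))) (signℕ-wt-split s)
  t+1≤n : suc t ≤ length (take n p)
  t+1≤n = subst (suc t ≤_) (sym (length-take≤ n p (subst (n ≤_) (sym ∣p∣≡) (ℕP.n≤1+n n))))
    (subst (suc t ≤_) s+t≡n (ℕP.+-monoˡ-≤ t 1≤s))
  Dk≡ : Dk ≡ Mid *ℤ yb
  Dk≡ = trans (cong (λ q → signℕ (wt (drop (suc t) q))) (∷ʳ-at-last p n ∣p∣≡))
    (trans (cong (signℕ ∘ wt) (drop-++ˡ (suc t) (take n p) [ b ] t+1≤n)) (signℕ-wt-++ mid [ b ]))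
  Ts≡ : Ts ≡ Mid *ℤ yn
  Ts≡ = trans (cong (signℕ ∘ wt) (mismatch-border p n s t ∣p∣≡ s+t≡n 1≤s δ≡s)) (signℕ-wt-++ mid [ not b ])
  shuffle : ∀ z yn yb t → (z *ℤ yn) *ℤ (t *ℤ (z *ℤ yb)) ≡ (z *ℤ z) *ℤ (yn *ℤ yb) *ℤ t
  shuffle = solve-∀

P-recurrence : ∀ p n s t → length p ≡ suc n → s + t ≡ n → δ p n (not (at p (suc n))) ≡ s →
  P p (suc n) ≋ X *ₚ P p n +ₚ signℕ (wt (drop s p)) ·ₚ P p s
P-recurrence p .(s + t) s t ∣p∣≡ refl δ≡s = ≋-trans (P-lastColumn p (s + t) s t ∣p∣≡ refl δ≡s)
  (+ₚ-cong (≋-refl {X *ₚ P p (s + t)}) (·ₚ-congʳ (P p s) (lastColumnCoefficient≡ p s t ∣p∣≡)))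

lemma12 : (p : List Bool) (k : ℕ) → 1 ≤ length p → 1 ≤ k → k ≤ length p →
    δ p (length p ∸ 1) (not (at p (length p))) ≡ length p ∸ k →
    (k < length p →
      P p (length p) ≈ₚ X *ₚ P p (length p ∸ 1) -ₚ signℕ (wt (take k p)) ·ₚ P p (length p ∸ k))
    × (k ≡ length p →
      P p (length p) ≈ₚ X *ₚ P p (length p ∸ 1) +ₚ constₚ (signℕ (wt p)))
lemma12 p@(_ ∷ xs) (suc t) _ _ (s≤s t≤n) δ≡s = k<m , k≡m
  where
  n s : ℕ
  n = length xs
  s = n ∸ t
  s+t≡n : s + t ≡ n
  s+t≡n = ℕP.m∸n+n≡m t≤n
  recurrence : P p (suc n) ≋ X *ₚ P p n +ₚ signℕ (wt (drop s p)) ·ₚ P p s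
  recurrence = P-recurrence p n s t refl s+t≡n δ≡s
  k<m : suc t < suc n → P p (suc n) ≈ₚ X *ₚ P p n -ₚ signℕ (wt (take (suc t) p)) ·ₚ P p s
  k<m (s≤s t<n) = coeff-≡ (≋-trans recurrence (+ₚ-cong (≋-refl {X *ₚ P p n})
    (≋-trans (·ₚ-congʳ (P p s) (signℕ-wt-drop-mismatch p n s t refl s+t≡n (ℕP.m<n⇒0<n∸m t<n) δ≡s))
      (≋-sym (·ₚ-assoc (- (+ 1)) _ (P p s))))))
  k≡m : suc t ≡ suc n → P p (suc n) ≈ₚ X *ₚ P p n +ₚ constₚ (signℕ (wt p))
  k≡m refl = coeff-≡ (≋-trans recurrence (+ₚ-cong (≋-refl {X *ₚ P p n})
    (subst (λ i → signℕ (wt (drop i p)) ·ₚ P p i ≋ constₚ (signℕ (wt p))) (sym (ℕP.n∸n≡0 n))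
      (·ₚ-P-zero (signℕ (wt p)) p))))
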